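{- Every sequent rule of the calculus LK$^=$ not involving quantifiers preserves validity when applied to arithmetic ground sentences. That is, for each of the rules listed in the context, in which all formulas occurring are arithmetic ground sentences: for an axiom rule with conclusion $\Gamma\vdash\Delta$ one has $I(\Gamma\vdash\Delta)=\top$; for a one-premise rule with premise $\Gamma'\vdash\Delta'$ and conclusion $\Gamma\vdash\Delta$, $I(\Gamma'\vdash\Delta')=\top$ implies $I(\Gamma\vdash\Delta)=\top$; for a two-premise rule with premises $\Gamma_1\vdash\Delta_1$, $\Gamma_2\vdash\Delta_2$ and conclusion $\Gamma\vdash\Delta$, $I(\Gamma_1\vdash\Delta_1)=\top$ and $I(\Gamma_2\vdash\Delta_2)=\top$ imply $I(\Gamma\vdash\Delta)=\top$.
   Context: Many-sorted first-order logic with equality over a signature with sorts $(u,v)\in O\times O$, zero constants $0_{u,v}$, other (non-zero) constants, and arithmetic function symbols $-$, $+$, $\cdot$ (sort-indexed). A ground sentence contains no variables; it is arithmetic if it contains only arithmetic function symbols. Idealisation: for an arithmetic ground sentence $\varphi$, terms are translated into the free algebra $\mathbb Z\langle X\rangle$ with one indeterminate $x_c$ per non-zero constant $c$ occurring, $0_{u,v}\mapsto0$ and $-,+,\cdot$ mapped to the ring operations; $s-t$ denotes the difference of images. $\mathrm{CNF}(\varphi)$ is obtained by exhaustively applying, in order, $\psi_1\rightarrow\psi_2\rightsquigarrow\lnot\psi_1\vee\psi_2$; $\lnot\lnot\psi\rightsquigarrow\psi$, $\lnot(\psi_1\wedge\psi_2)\rightsquigarrow\lnot\psi_1\vee\lnot\psi_2$,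 $\lnot(\psi_1\vee\psi_2)\rightsquigarrow\lnot\psi_1\wedge\lnot\psi_2$; $\psi\vee(\psi_1\wedge\psi_2)\rightsquigarrow(\psi\vee\psi_1)\wedge(\psi\vee\psi_2)$, modulo associativity/commutativity of $\wedge,\vee$. For a clause $C=\bigvee_{j=1}^n s_j\not\approx t_j\vee\bigvee_{k=1}^{n'}p_k\approx q_k$, $I(C)$ holds iff $p_k-q_k$ lies in the two-sided ideal of $\mathbb Z\langle X\rangle$ generated by $s_1-t_1,\dots,s_n-t_n$ for some $k$; $I(\varphi)$ is the conjunction of $I(C)$ over all clauses of $\mathrm{CNF}(\varphi)$. A sequent $\Gamma\vdash\Delta$ has finite multisets $\Gamma,\Delta$ of formulas, and $I(\Gamma\vdash\Delta):=I\big(\bigvee_{\gamma\in\Gamma}\lnot\gamma\vee\bigvee_{\delta\in\Delta}\delta\big)$. The quantifier-free rules of LK$^=$ (written premise(s) $/$ conclusion; $\Gamma,\varphi$ means $\Gamma\cup\{\varphi\}$): axioms (Ax) $/\ \Gamma,s\approx t\vdash\Delta,s\approx t$ and (Ref) $/\ \Gamma\vdash\Delta,t\approx t$; weakening $\Gamma\vdash\Delta\,/\,\Gamma,\varphi\vdash\Delta$ and $\Gamma\vdash\Delta\,/\,\Gamma\vdash\Delta,\varphi$; contraction $\Gamma,\varphi,\varphi\vdash\Delta\,/\,\Gamma,\varphi\vdash\Delta$ and $\Gamma\vdash\Delta,\varphi,\varphi\,/\,\Gamma\vdash\Delta,\varphi$; $\Gamma\vdash\Delta,\varphi\,/\,\Gamma,\lnot\varphi\vdash\Delta$;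 $\Gamma,\varphi\vdash\Delta\,/\,\Gamma\vdash\Delta,\lnot\varphi$; $\Gamma,\varphi\vdash\Delta$ and $\Gamma,\psi\vdash\Delta\,/\,\Gamma,\varphi\vee\psi\vdash\Delta$; $\Gamma\vdash\Delta,\varphi,\psi\,/\,\Gamma\vdash\Delta,\varphi\vee\psi$; $\Gamma,\varphi,\psi\vdash\Delta\,/\,\Gamma,\varphi\wedge\psi\vdash\Delta$; $\Gamma\vdash\Delta,\varphi$ and $\Gamma\vdash\Delta,\psi\,/\,\Gamma\vdash\Delta,\varphi\wedge\psi$; $\Gamma\vdash\Delta,\varphi$ and $\Gamma,\psi\vdash\Delta\,/\,\Gamma,\varphi\rightarrow\psi\vdash\Delta$; $\Gamma,\varphi\vdash\Delta,\psi\,/\,\Gamma\vdash\Delta,\varphi\rightarrow\psi$; and the equational rule (Sub) $\Gamma,\varphi[x\mapsto t],s\approx t\vdash\Delta\,/\,\Gamma,\varphi[x\mapsto s],s\approx t\vdash\Delta$ where $x$ has the sort of $s$ and $\varphi[x\mapsto r]$ denotes substitution of $r$ for $x$. -}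

module Defs where

open import Data.Product using (Σ; ∃; _×_; _,_)
open import Data.List using (List; []; _∷_; _++_; map; concatMap)
open import Data.List.Membership.Propositional using (_∈_)
open import Data.List.Relation.Unary.All using (All)
open import Data.List.Relation.Unary.Any using (Any)
open import Data.List.Relation.Binary.Permutation.Propositional using (_↭_)

-- A many-sorted signature: a set O of "objects"; sorts are pairs (u,v);
-- C u v is the set of non-zero constants of sort (u,v).

module Sig (O : Set) (C : O → O → Set) where

  infixl 6 _⊕_
  infixl 7 _⊙_

  data Tm (V : O → O → Set) : O → O → Set where
    var : ∀ {u v} → V u v → Tm V u v
    𝟘   : ∀ {u v} → Tm V u v
    con : ∀ {u v} → C u v → Tm V u v
    neg : ∀ {u v} → Tm V u v → Tm V u v
    _⊕_ : ∀ {u v} → Tm V u v → Tm V u v → Tm V u v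
    _⊙_ : ∀ {u v w} → Tm V u v → Tm V v w → Tm V u w

  data NoVar : O → O → Set where

  data Var1 (a b : O) : O → O → Set where
    x : Var1 a b a b

  infix 4 _≈_
  infix 3 ¬_
  infixr 2 _∧_
  infixr 1 _∨_
  infixr 0 _⇒_

  data Fm (V : O → O → Set) : Set where
    _≈_ : ∀ {u v} → Tm V u v → Tm V u v → Fm V
    ¬_  : Fm V → Fm V
    _∧_ : Fm V → Fm V → Fm V
    _∨_ : Fm V → Fm V → Fm V
    _⇒_ : Fm V → Fm V → Fm V

  GTm : O → O → Set
  GTm = Tm NoVar

  Sen : Set
  Sen = Fm NoVar

  substTm : ∀ {a b u v} → Tm (Var1 a b) u v → GTm a b → GTm u v
  substTm (var x) r = r
  substTm 𝟘 r = 𝟘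
  substTm (con c) r = con c
  substTm (neg s) r = neg (substTm s r)
  substTm (s ⊕ t) r = substTm s r ⊕ substTm t r
  substTm (s ⊙ t) r = substTm s r ⊙ substTm t r

  _[x↦_] : ∀ {a b} → Fm (Var1 a b) → GTm a b → Sen
  (s ≈ t) [x↦ r ] = substTm s r ≈ substTm t r
  (¬ φ) [x↦ r ] = ¬ (φ [x↦ r ])
  (φ ∧ ψ) [x↦ r ] = (φ [x↦ r ]) ∧ (ψ [x↦ r ])
  (φ ∨ ψ) [x↦ r ] = (φ [x↦ r ]) ∨ (ψ [x↦ r ])
  (φ ⇒ ψ) [x↦ r ] = (φ [x↦ r ]) ⇒ (ψ [x↦ r ])

  -- The free algebra ℤ⟨X⟩ (= free unital associative ring) on one
  -- indeterminate x_c per non-zero constant c: formal ring expressions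
  -- modulo the congruence generated by the ring axioms.

  Ind : Set
  Ind = Σ O λ u → Σ O λ v → C u v

  infixl 6 _+ᵖ_
  infixl 7 _*ᵖ_

  data Poly : Set where
    0ᵖ   : Poly
    1ᵖ   : Poly
    X    : Ind → Poly
    -ᵖ_  : Poly → Poly
    _+ᵖ_ : Poly → Poly → Poly
    _*ᵖ_ : Poly → Poly → Poly

  infix 4 _≃_
  data _≃_ : Poly → Poly → Set where
    ≃-refl  : ∀ {p} → p ≃ p
    ≃-sym   : ∀ {p q} → p ≃ q → q ≃ p
    ≃-trans : ∀ {p q r} → p ≃ q → q ≃ r → p ≃ r
    -cong   : ∀ {p q} → p ≃ q → -ᵖ p ≃ -ᵖ q
    +cong   : ∀ {p p' q q'} → p ≃ p' → q ≃ q' → p +ᵖ q ≃ p' +ᵖ q'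
    *cong   : ∀ {p p' q q'} → p ≃ p' → q ≃ q' → p *ᵖ q ≃ p' *ᵖ q'
    +assoc  : ∀ p q r → (p +ᵖ q) +ᵖ r ≃ p +ᵖ (q +ᵖ r)
    +comm   : ∀ p q → p +ᵖ q ≃ q +ᵖ p
    +idʳ    : ∀ p → p +ᵖ 0ᵖ ≃ p
    -invʳ   : ∀ p → p +ᵖ (-ᵖ p) ≃ 0ᵖ
    *assoc  : ∀ p q r → (p *ᵖ q) *ᵖ r ≃ p *ᵖ (q *ᵖ r)
    *idˡ    : ∀ p → 1ᵖ *ᵖ p ≃ p
    *idʳ    : ∀ p → p *ᵖ 1ᵖ ≃ p
    distribˡ : ∀ p q r → p *ᵖ (q +ᵖ r) ≃ (p *ᵖ q) +ᵖ (p *ᵖ r)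
    distribʳ : ∀ p q r → (q +ᵖ r) *ᵖ p ≃ (q *ᵖ p) +ᵖ (r *ᵖ p)

  data InIdeal (G : List Poly) : Poly → Set where
    gen  : ∀ {g} → g ∈ G → InIdeal G g
    zero : InIdeal G 0ᵖ
    add  : ∀ {p q} → InIdeal G p → InIdeal G q → InIdeal G (p +ᵖ q)
    mulˡ : ∀ a {p} → InIdeal G p → InIdeal G (a *ᵖ p)
    mulʳ : ∀ {p} b → InIdeal G p → InIdeal G (p *ᵖ b)
    resp : ∀ {p q} → p ≃ q → InIdeal G p → InIdeal G q

  ⟦_⟧ : ∀ {u v} → GTm u v → Poly
  ⟦ var () ⟧
  ⟦ 𝟘 ⟧ = 0ᵖ
  ⟦ con {u} {v} c ⟧ = X (u , v , c)
  ⟦ neg s ⟧ = -ᵖ ⟦ s ⟧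
  ⟦ s ⊕ t ⟧ = ⟦ s ⟧ +ᵖ ⟦ t ⟧
  ⟦ s ⊙ t ⟧ = ⟦ s ⟧ *ᵖ ⟦ t ⟧

  Eqn : Set
  Eqn = Σ O λ u → Σ O λ v → GTm u v × GTm u v

  diff : Eqn → Poly
  diff (_ , _ , s , t) = ⟦ s ⟧ +ᵖ (-ᵖ ⟦ t ⟧)

  -- clause  ⋁ sⱼ ≉ tⱼ ∨ ⋁ pₖ ≈ qₖ  (negative literals, positive literals)
  record Clause : Set where
    constructor clause
    field
      negs : List Eqn
      poss : List Eqn
  open Clause public

  _∪ᶜ_ : Clause → Clause → Clause
  clause n₁ p₁ ∪ᶜ clause n₂ p₂ = clause (n₁ ++ n₂) (p₁ ++ p₂)

  -- CNF of a disjunction of two CNFs (distribution)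
  _⊗_ : List Clause → List Clause → List Clause
  A ⊗ B = concatMap (λ c → map (c ∪ᶜ_) B) A

  -- cnf⁺ φ = CNF(φ),  cnf⁻ φ = CNF(¬φ), as multisets of clauses
  cnf⁺ cnf⁻ : Sen → List Clause
  cnf⁺ (_≈_ {u} {v} s t) = clause [] ((u , v , s , t) ∷ []) ∷ []
  cnf⁺ (¬ φ) = cnf⁻ φ
  cnf⁺ (φ ∧ ψ) = cnf⁺ φ ++ cnf⁺ ψ
  cnf⁺ (φ ∨ ψ) = cnf⁺ φ ⊗ cnf⁺ ψ
  cnf⁺ (φ ⇒ ψ) = cnf⁻ φ ⊗ cnf⁺ ψ
  cnf⁻ (_≈_ {u} {v} s t) = clause ((u , v , s , t) ∷ []) [] ∷ []
  cnf⁻ (¬ φ) = cnf⁺ φ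
  cnf⁻ (φ ∧ ψ) = cnf⁻ φ ⊗ cnf⁻ ψ
  cnf⁻ (φ ∨ ψ) = cnf⁻ φ ++ cnf⁻ ψ
  cnf⁻ (φ ⇒ ψ) = cnf⁺ φ ++ cnf⁻ ψ

  CNF : Sen → List Clause
  CNF = cnf⁺

  IClause : Clause → Set
  IClause C = Any (λ e → InIdeal (map diff (negs C)) (diff e)) (poss C)

  ICNF : List Clause → Set
  ICNF = All IClause

  I : Sen → Set
  I φ = ICNF (CNF φ)

  -- Sequents Γ ⊢ Δ (multisets represented by lists, see _≋_ below)

  infix 1 _⊢_
  record Seq : Set where
    constructor _⊢_
    field
      ante : List Sen
      succ : List Sen

  -- CNF of the disjunction of a list of formulas (empty disjunction = ⊥,
  -- whose CNF is the single empty clause)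
  cnfDisj : List (List Clause) → List Clause
  cnfDisj [] = clause [] [] ∷ []
  cnfDisj (A ∷ As) = A ⊗ cnfDisj As

  ISeq : Seq → Set
  ISeq (Γ ⊢ Δ) = ICNF (cnfDisj (map (λ γ → CNF (¬ γ)) Γ ++ map CNF Δ))

  infix 0 _≋_
  _≋_ : Seq → Seq → Set
  (Γ ⊢ Δ) ≋ (Γ' ⊢ Δ') = (Γ ↭ Γ') × (Δ ↭ Δ')

  -- Quantifier-free rules of LK⁼ (principal formulas written first)

  data Axiom : Seq → Set where
    ax  : ∀ {Γ Δ u v} (s t : GTm u v) → Axiom ((s ≈ t) ∷ Γ ⊢ (s ≈ t) ∷ Δ)
    ref : ∀ {Γ Δ u v} (t : GTm u v) → Axiom (Γ ⊢ (t ≈ t) ∷ Δ)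

  data Rule₁ : Seq → Seq → Set where
    weakL  : ∀ {Γ Δ} φ → Rule₁ (Γ ⊢ Δ) (φ ∷ Γ ⊢ Δ)
    weakR  : ∀ {Γ Δ} φ → Rule₁ (Γ ⊢ Δ) (Γ ⊢ φ ∷ Δ)
    contrL : ∀ {Γ Δ} φ → Rule₁ (φ ∷ φ ∷ Γ ⊢ Δ) (φ ∷ Γ ⊢ Δ)
    contrR : ∀ {Γ Δ} φ → Rule₁ (Γ ⊢ φ ∷ φ ∷ Δ) (Γ ⊢ φ ∷ Δ)
    ¬L     : ∀ {Γ Δ} φ → Rule₁ (Γ ⊢ φ ∷ Δ) ((¬ φ) ∷ Γ ⊢ Δ)
    ¬R     : ∀ {Γ Δ} φ → Rule₁ (φ ∷ Γ ⊢ Δ) (Γ ⊢ (¬ φ) ∷ Δ)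
    ∨R     : ∀ {Γ Δ} φ ψ → Rule₁ (Γ ⊢ φ ∷ ψ ∷ Δ) (Γ ⊢ (φ ∨ ψ) ∷ Δ)
    ∧L     : ∀ {Γ Δ} φ ψ → Rule₁ (φ ∷ ψ ∷ Γ ⊢ Δ) ((φ ∧ ψ) ∷ Γ ⊢ Δ)
    ⇒R     : ∀ {Γ Δ} φ ψ → Rule₁ (φ ∷ Γ ⊢ ψ ∷ Δ) (Γ ⊢ (φ ⇒ ψ) ∷ Δ)
    sub    : ∀ {Γ Δ a b} (φ : Fm (Var1 a b)) (s t : GTm a b) →
             Rule₁ ((φ [x↦ t ]) ∷ (s ≈ t) ∷ Γ ⊢ Δ)
                   ((φ [x↦ s ]) ∷ (s ≈ t) ∷ Γ ⊢ Δ)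

  data Rule₂ : Seq → Seq → Seq → Set where
    ∨L : ∀ {Γ Δ} φ ψ → Rule₂ (φ ∷ Γ ⊢ Δ) (ψ ∷ Γ ⊢ Δ) ((φ ∨ ψ) ∷ Γ ⊢ Δ)
    ∧R : ∀ {Γ Δ} φ ψ → Rule₂ (Γ ⊢ φ ∷ Δ) (Γ ⊢ ψ ∷ Δ) (Γ ⊢ (φ ∧ ψ) ∷ Δ)
    ⇒L : ∀ {Γ Δ} φ ψ → Rule₂ (Γ ⊢ φ ∷ Δ) (ψ ∷ Γ ⊢ Δ) ((φ ⇒ ψ) ∷ Γ ⊢ Δ)

  -- rule instances on multiset sequents (any arrangement of the lists)
  Axiomᵐ : Seq → Set
  Axiomᵐ S = ∃ λ S₀ → Axiom S₀ × (S ≋ S₀)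

  Rule₁ᵐ : Seq → Seq → Set
  Rule₁ᵐ P S = ∃ λ P₀ → ∃ λ S₀ → Rule₁ P₀ S₀ × (P ≋ P₀) × (S ≋ S₀)

  Rule₂ᵐ : Seq → Seq → Seq → Set
  Rule₂ᵐ P Q S = ∃ λ P₀ → ∃ λ Q₀ → ∃ λ S₀ →
    Rule₂ P₀ Q₀ S₀ × (P ≋ P₀) × (Q ≋ Q₀) × (S ≋ S₀)

-- A clause of CNF(⋁ Γ ∨ ⋁ Δ) is obtained by choosing one clause from the CNF
-- of each member of the disjunction and taking their union.  Idealisation of
-- a clause only grows when literals are added (more generators make a larger
-- ideal, more positive literals give more chances), so weakening,
-- contraction, exchange and the propositional rules reduce to bookkeeping on
-- such choices.  The axioms hold because s − t lies in the ideal generated by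
-- s − t, and t − t = 0.  For the substitution rule, substituting s or t into
-- the same term gives polynomials congruent modulo the ideal generated by
-- s − t, so corresponding clauses of CNF(φ[x ↦ s]) and CNF(φ[x ↦ t]) have
-- the same idealisation once s ≉ t is among their negative literals.

module Submission where

open import Defs
open import Algebra.Bundles using (Ring)
open import Algebra.Structures using (IsRing)
import Algebra.Properties.Ring as RingProperties
import Algebra.Properties.AbelianGroup as AbelianGroupProperties
import Algebra.Properties.CommutativeSemigroup as CommutativeSemigroupProperties
open import Data.List using (List; []; _∷_; _++_; map)
open import Data.List.Properties using (++-assoc)
open import Data.List.Membership.Propositional using (_∈_; find)
open import Data.List.Membership.Propositional.Properties
  using (∈-map⁺; ∈-map⁻; ∈-++⁺ʳ; ∈-++⁻; ∈-concatMap⁺; ∈-concatMap⁻)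
open import Data.List.Relation.Unary.Any as Any using (Any; here; there)
open import Data.List.Relation.Unary.Any.Properties using (lift-resp)
open import Data.List.Relation.Unary.All as All using (All)
import Data.List.Relation.Unary.All.Properties as All
open import Data.List.Relation.Binary.Pointwise as Pointwise using (Pointwise; []; _∷_)
open import Data.List.Relation.Binary.Subset.Propositional using (_⊆_)
open import Data.List.Relation.Binary.Subset.Propositional.Properties as ⊆
  using (Any-resp-⊆; ⊆-refl; ⊆-trans; ⊆-reflexive; ⊆-reflexive-↭; xs⊆xs++ys; xs⊆ys++xs)
open import Data.List.Relation.Binary.Permutation.Propositional
  using (_↭_; refl; prep; swap; trans; ↭-sym)
import Data.List.Relation.Binary.Permutation.Propositional.Properties as ↭
open import Data.Product using (∃; _×_; _,_)
open import Data.Sum using ([_,_]′)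
open import Function using (_∘_; id)
open import Relation.Binary.Structures using (IsEquivalence)
import Relation.Binary.Reasoning.Setoid as ≈-Reasoning
open import Relation.Binary.PropositionalEquality using (_≡_; refl; sym)

++-idem-⊆ : ∀ {A : Set} (xs ys : List A) → xs ++ (xs ++ ys) ⊆ xs ++ ys
++-idem-⊆ xs ys = [ xs⊆xs++ys xs ys , id ]′ ∘ ∈-++⁻ xs

Pointwise-∈ˡ : ∀ {A B : Set} {R : A → B → Set} {xs ys x} →
               Pointwise R xs ys → x ∈ xs → ∃ λ y → y ∈ ys × R x y
Pointwise-∈ˡ (r ∷ rs) (here refl) = _ , here refl , r
Pointwise-∈ˡ (r ∷ rs) (there x∈) with Pointwise-∈ˡ rs x∈
... | y , y∈ , r′ = y , there y∈ , r′

module Soundness (O : Set) (C : O → O → Set) where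
  open Sig O C

  ≃-isEquivalence : IsEquivalence _≃_
  ≃-isEquivalence = record { refl = ≃-refl ; sym = ≃-sym ; trans = ≃-trans }

  Poly-isRing : IsRing _≃_ _+ᵖ_ _*ᵖ_ -ᵖ_ 0ᵖ 1ᵖ
  Poly-isRing = record
    { +-isAbelianGroup = record
      { isGroup = record
        { isMonoid = record
          { isSemigroup = record
            { isMagma = record { isEquivalence = ≃-isEquivalence ; ∙-cong = +cong }
            ; assoc = +assoc }
          ; identity = (λ p → ≃-trans (+comm 0ᵖ p) (+idʳ p)) , +idʳ }
        ; inverse = (λ p → ≃-trans (+comm (-ᵖ p) p) (-invʳ p)) , -invʳ
        ; ⁻¹-cong = -cong }
      ; comm = +comm }
    ; *-cong = *cong
    ; *-assoc = *assoc
    ; *-identity = *idˡ , *idʳ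
    ; distrib = distribˡ , distribʳ
    }

  Poly-ring : Ring _ _
  Poly-ring = record { isRing = Poly-isRing }

  open Ring Poly-ring using (-‿inverseˡ; +-identityˡ)
  open RingProperties Poly-ring using (-1*x≈-x; x[y-z]≈xy-xz; [y-z]x≈yx-zx)
  open AbelianGroupProperties (Ring.+-abelianGroup Poly-ring)
    using (⁻¹-anti-homo‿-; ⁻¹-∙-comm; ε⁻¹≈ε; x≈y⇒x∙y⁻¹≈ε)
  open CommutativeSemigroupProperties (Ring.+-commutativeSemigroup Poly-ring)
    using (interchange)

  infix 4 _∼[_]_
  _∼[_]_ : Poly → List Poly → Poly → Set
  p ∼[ G ] q = InIdeal G (p +ᵖ -ᵖ q)

  InIdeal-neg : ∀ {G p} → InIdeal G p → InIdeal G (-ᵖ p)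
  InIdeal-neg {p = p} p∈ = resp (-1*x≈-x p) (mulˡ (-ᵖ 1ᵖ) p∈)

  InIdeal-mono : ∀ {G H p} → All (InIdeal H) G → InIdeal G p → InIdeal H p
  InIdeal-mono G⊆H (gen g∈)    = All.lookup G⊆H g∈
  InIdeal-mono G⊆H zero        = zero
  InIdeal-mono G⊆H (add p∈ q∈) = add (InIdeal-mono G⊆H p∈) (InIdeal-mono G⊆H q∈)
  InIdeal-mono G⊆H (mulˡ a p∈) = mulˡ a (InIdeal-mono G⊆H p∈)
  InIdeal-mono G⊆H (mulʳ b p∈) = mulʳ b (InIdeal-mono G⊆H p∈)
  InIdeal-mono G⊆H (resp e p∈) = resp e (InIdeal-mono G⊆H p∈)

  ∼-reflexive : ∀ {G p q} → p ≃ q → p ∼[ G ] q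
  ∼-reflexive p≃q = resp (≃-sym (x≈y⇒x∙y⁻¹≈ε p≃q)) zero

  ∼-refl : ∀ {G p} → p ∼[ G ] p
  ∼-refl = ∼-reflexive ≃-refl

  ∼-sym : ∀ {G p q} → p ∼[ G ] q → q ∼[ G ] p
  ∼-sym {p = p} {q} p∼q = resp (⁻¹-anti-homo‿- p q) (InIdeal-neg p∼q)

  -+-telescope : ∀ p q r → (p +ᵖ -ᵖ q) +ᵖ (q +ᵖ -ᵖ r) ≃ p +ᵖ -ᵖ r
  -+-telescope p q r = begin
    (p +ᵖ -ᵖ q) +ᵖ (q +ᵖ -ᵖ r)  ≈⟨ +assoc p (-ᵖ q) (q +ᵖ -ᵖ r) ⟩
    p +ᵖ (-ᵖ q +ᵖ (q +ᵖ -ᵖ r))  ≈⟨ +cong ≃-refl (≃-sym (+assoc (-ᵖ q) q (-ᵖ r))) ⟩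
    p +ᵖ ((-ᵖ q +ᵖ q) +ᵖ -ᵖ r)  ≈⟨ +cong ≃-refl (+cong (-‿inverseˡ q) ≃-refl) ⟩
    p +ᵖ (0ᵖ +ᵖ -ᵖ r)           ≈⟨ +cong ≃-refl (+-identityˡ (-ᵖ r)) ⟩
    p +ᵖ -ᵖ r                   ∎
    where open ≈-Reasoning (Ring.setoid Poly-ring)

  ∼-trans : ∀ {G p q r} → p ∼[ G ] q → q ∼[ G ] r → p ∼[ G ] r
  ∼-trans {p = p} {q} {r} p∼q q∼r = resp (-+-telescope p q r) (add p∼q q∼r)

  ∼-neg : ∀ {G p q} → p ∼[ G ] q → -ᵖ p ∼[ G ] -ᵖ q
  ∼-neg {p = p} {q} p∼q = resp (≃-sym (⁻¹-∙-comm p (-ᵖ q))) (InIdeal-neg p∼q)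

  ∼-+ : ∀ {G p p′ q q′} → p ∼[ G ] p′ → q ∼[ G ] q′ → p +ᵖ q ∼[ G ] p′ +ᵖ q′
  ∼-+ {p = p} {p′} {q} {q′} p∼p′ q∼q′ =
    resp (≃-sym (≃-trans (+cong ≃-refl (≃-sym (⁻¹-∙-comm p′ q′)))
                         (interchange p q (-ᵖ p′) (-ᵖ q′))))
         (add p∼p′ q∼q′)

  -- p q − p′ q′ = p (q − q′) + (p − p′) q′
  ∼-* : ∀ {G p p′ q q′} → p ∼[ G ] p′ → q ∼[ G ] q′ → p *ᵖ q ∼[ G ] p′ *ᵖ q′
  ∼-* {p = p} {p′} {q} {q′} p∼p′ q∼q′ =
    resp (≃-trans (+cong (x[y-z]≈xy-xz p q q′) ([y-z]x≈yx-zx q′ p p′))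
                  (-+-telescope (p *ᵖ q) (p *ᵖ q′) (p′ *ᵖ q′)))
         (add (mulˡ p q∼q′) (mulʳ q′ p∼p′))

  InIdeal⇒∼0 : ∀ {G p} → InIdeal G p → p ∼[ G ] 0ᵖ
  InIdeal⇒∼0 {p = p} = resp (≃-sym (≃-trans (+cong ≃-refl ε⁻¹≈ε) (+idʳ p)))

  ∼0⇒InIdeal : ∀ {G p} → p ∼[ G ] 0ᵖ → InIdeal G p
  ∼0⇒InIdeal {p = p} = resp (≃-trans (+cong ≃-refl ε⁻¹≈ε) (+idʳ p))

  InIdeal-resp-∼ : ∀ {G p q} → p ∼[ G ] q → InIdeal G p → InIdeal G q
  InIdeal-resp-∼ p∼q p∈ = ∼0⇒InIdeal (∼-trans (∼-sym p∼q) (InIdeal⇒∼0 p∈))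

  infix 4 _⊑_
  _⊑_ : Clause → Clause → Set
  c ⊑ d = negs c ⊆ negs d × poss c ⊆ poss d

  ⊑-refl : ∀ {c} → c ⊑ c
  ⊑-refl = ⊆-refl , ⊆-refl

  ⊑-trans : ∀ {c d e} → c ⊑ d → d ⊑ e → c ⊑ e
  ⊑-trans (n , p) (n′ , p′) = ⊆-trans n n′ , ⊆-trans p p′

  ∪ᶜ-mono : ∀ {c c′ d d′} → c ⊑ c′ → d ⊑ d′ → c ∪ᶜ d ⊑ c′ ∪ᶜ d′
  ∪ᶜ-mono (n , p) (n′ , p′) = ⊆.++⁺ n n′ , ⊆.++⁺ p p′

  ∪ᶜ-upperʳ : ∀ c d → d ⊑ c ∪ᶜ d
  ∪ᶜ-upperʳ c d = xs⊆ys++xs (negs d) (negs c) , xs⊆ys++xs (poss d) (poss c)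

  ∪ᶜ-idem : ∀ c d → c ∪ᶜ (c ∪ᶜ d) ⊑ c ∪ᶜ d
  ∪ᶜ-idem c d = ++-idem-⊆ (negs c) (negs d) , ++-idem-⊆ (poss c) (poss d)

  ∪ᶜ-assoc : ∀ c d e → c ∪ᶜ (d ∪ᶜ e) ⊑ (c ∪ᶜ d) ∪ᶜ e
  ∪ᶜ-assoc c d e = ⊆-reflexive (sym (++-assoc (negs c) (negs d) (negs e)))
                 , ⊆-reflexive (sym (++-assoc (poss c) (poss d) (poss e)))

  ∪ᶜ-swap : ∀ c d e → c ∪ᶜ (d ∪ᶜ e) ⊑ d ∪ᶜ (c ∪ᶜ e)
  ∪ᶜ-swap c d e = ⊆-reflexive-↭ (↭.shifts (negs c) (negs d))
                , ⊆-reflexive-↭ (↭.shifts (poss c) (poss d))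

  IClause-mono : ∀ {c d} → c ⊑ d → IClause c → IClause d
  IClause-mono (n , p) =
    Any-resp-⊆ p ∘ Any.map (InIdeal-mono (All.tabulate (gen ∘ ⊆.map⁺ diff n)))

  ∈-⊗⁺ : ∀ {A B a b} → a ∈ A → b ∈ B → a ∪ᶜ b ∈ A ⊗ B
  ∈-⊗⁺ {A} {B} {a} {b} a∈ b∈ =
    ∈-concatMap⁺ (λ c → map (c ∪ᶜ_) B) {A}
      (Any.map (λ { refl → ∈-map⁺ (a ∪ᶜ_) b∈ }) a∈)

  ∈-⊗⁻ : ∀ {A B d} → d ∈ A ⊗ B → ∃ λ a → ∃ λ b → a ∈ A × b ∈ B × d ≡ a ∪ᶜ b
  ∈-⊗⁻ {A} {B} d∈ with find (∈-concatMap⁻ (λ c → map (c ∪ᶜ_) B) {A} d∈)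
  ... | a , a∈ , d∈a∪B with ∈-map⁻ (a ∪ᶜ_) d∈a∪B
  ... | b , b∈ , d≡a∪b = a , b , a∈ , b∈ , d≡a∪b

  infixr 5 _∷_
  data Selection : List (List Clause) → Clause → Set where
    []  : Selection [] (clause [] [])
    _∷_ : ∀ {A L c d} → c ∈ A → Selection L d → Selection (A ∷ L) (c ∪ᶜ d)

  ∈-cnfDisj⁺ : ∀ {L D} → Selection L D → D ∈ cnfDisj L
  ∈-cnfDisj⁺ []         = here refl
  ∈-cnfDisj⁺ (c∈ ∷ sel) = ∈-⊗⁺ c∈ (∈-cnfDisj⁺ sel)

  ∈-cnfDisj⁻ : ∀ L {D} → D ∈ cnfDisj L → Selection L D
  ∈-cnfDisj⁻ []      (here refl) = []
  ∈-cnfDisj⁻ (A ∷ L) D∈ with ∈-⊗⁻ {A} {cnfDisj L} D∈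
  ... | a , b , a∈ , b∈ , refl = a∈ ∷ ∈-cnfDisj⁻ L b∈

  IDisj : List (List Clause) → Set
  IDisj L = ∀ {D} → Selection L D → IClause D

  ICNF⇒IDisj : ∀ {L} → ICNF (cnfDisj L) → IDisj L
  ICNF⇒IDisj valid = All.lookup valid ∘ ∈-cnfDisj⁺

  IDisj⇒ICNF : ∀ L → IDisj L → ICNF (cnfDisj L)
  IDisj⇒ICNF L valid = All.tabulate (valid ∘ ∈-cnfDisj⁻ L)

  Selection-resp-↭ : ∀ {L L′ D} → L ↭ L′ → Selection L D →
                     ∃ λ D′ → Selection L′ D′ × D′ ⊑ D
  Selection-resp-↭ refl sel = _ , sel , ⊑-refl
  Selection-resp-↭ (prep _ L↭L′) (c∈ ∷ sel) with Selection-resp-↭ L↭L′ sel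
  ... | _ , sel′ , D′⊑D = _ , c∈ ∷ sel′ , ∪ᶜ-mono ⊑-refl D′⊑D
  Selection-resp-↭ (swap _ _ L↭L′) (_∷_ {c = c} c∈ (_∷_ {c = d} d∈ sel))
    with Selection-resp-↭ L↭L′ sel
  ... | e′ , sel′ , e′⊑e =
    _ , d∈ ∷ c∈ ∷ sel′ ,
    ⊑-trans {d ∪ᶜ (c ∪ᶜ e′)} (∪ᶜ-mono {d} ⊑-refl (∪ᶜ-mono {c} ⊑-refl e′⊑e)) (∪ᶜ-swap d c _)
  Selection-resp-↭ (trans L↭L′ L′↭L″) sel with Selection-resp-↭ L↭L′ sel
  ... | _ , sel′ , D′⊑D with Selection-resp-↭ L′↭L″ sel′
  ... | _ , sel″ , D″⊑D′ = _ , sel″ , ⊑-trans D″⊑D′ D′⊑D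

  IDisj-resp-↭ : ∀ {L L′} → L ↭ L′ → IDisj L → IDisj L′
  IDisj-resp-↭ L↭L′ valid sel with Selection-resp-↭ (↭-sym L↭L′) sel
  ... | _ , sel′ , D′⊑D = IClause-mono D′⊑D (valid sel′)

  IDisj-weaken : ∀ {A L} → IDisj L → IDisj (A ∷ L)
  IDisj-weaken valid (_∷_ {c = c} {d} _ sel) = IClause-mono (∪ᶜ-upperʳ c d) (valid sel)

  IDisj-contract : ∀ {A L} → IDisj (A ∷ A ∷ L) → IDisj (A ∷ L)
  IDisj-contract valid (_∷_ {c = c} {d} c∈ sel) = IClause-mono (∪ᶜ-idem c d) (valid (c∈ ∷ c∈ ∷ sel))

  IDisj-⊗ : ∀ {A B L} → IDisj (A ∷ B ∷ L) → IDisj (A ⊗ B ∷ L)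
  IDisj-⊗ {A} {B} valid (_∷_ {d = d} c∈ sel) with ∈-⊗⁻ {A} {B} c∈
  ... | a , b , a∈ , b∈ , refl = IClause-mono (∪ᶜ-assoc a b d) (valid (a∈ ∷ b∈ ∷ sel))

  IDisj-++ : ∀ {A B L} → IDisj (A ∷ L) → IDisj (B ∷ L) → IDisj ((A ++ B) ∷ L)
  IDisj-++ {A} validA validB (c∈ ∷ sel) =
    [ (λ c∈A → validA (c∈A ∷ sel)) , (λ c∈B → validB (c∈B ∷ sel)) ]′ (∈-++⁻ A c∈)

  cnfs : List Sen → List Sen → List (List Clause)
  cnfs Γ Δ = map (λ γ → CNF (¬ γ)) Γ ++ map CNF Δ

  ISeq⇒IDisj : ∀ Γ Δ → ISeq (Γ ⊢ Δ) → IDisj (cnfs Γ Δ)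
  ISeq⇒IDisj Γ Δ = ICNF⇒IDisj

  IDisj⇒ISeq : ∀ Γ Δ → IDisj (cnfs Γ Δ) → ISeq (Γ ⊢ Δ)
  IDisj⇒ISeq Γ Δ = IDisj⇒ICNF (cnfs Γ Δ)

  cnfs-succ-↭ : ∀ Γ Δ φ → cnfs Γ (φ ∷ Δ) ↭ CNF φ ∷ cnfs Γ Δ
  cnfs-succ-↭ Γ Δ φ = ↭.shift (CNF φ) (map (λ γ → CNF (¬ γ)) Γ) (map CNF Δ)

  ISeq⇒IDisj-succ : ∀ Γ Δ φ → ISeq (Γ ⊢ φ ∷ Δ) → IDisj (CNF φ ∷ cnfs Γ Δ)
  ISeq⇒IDisj-succ Γ Δ φ = IDisj-resp-↭ (cnfs-succ-↭ Γ Δ φ) ∘ ISeq⇒IDisj Γ (φ ∷ Δ)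

  IDisj⇒ISeq-succ : ∀ Γ Δ φ → IDisj (CNF φ ∷ cnfs Γ Δ) → ISeq (Γ ⊢ φ ∷ Δ)
  IDisj⇒ISeq-succ Γ Δ φ = IDisj⇒ISeq Γ (φ ∷ Δ) ∘ IDisj-resp-↭ (↭-sym (cnfs-succ-↭ Γ Δ φ))

  ≋-sym : ∀ {S S′} → S ≋ S′ → S′ ≋ S
  ≋-sym (Γ↭Γ′ , Δ↭Δ′) = ↭-sym Γ↭Γ′ , ↭-sym Δ↭Δ′

  ISeq-resp-≋ : ∀ {S S′} → S ≋ S′ → ISeq S → ISeq S′
  ISeq-resp-≋ {Γ ⊢ Δ} {Γ′ ⊢ Δ′} (Γ↭Γ′ , Δ↭Δ′) =
    IDisj⇒ISeq Γ′ Δ′ ∘ IDisj-resp-↭ cnfs↭cnfs′ ∘ ISeq⇒IDisj Γ Δ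
    where
    cnfs↭cnfs′ : cnfs Γ Δ ↭ cnfs Γ′ Δ′
    cnfs↭cnfs′ = ↭.++⁺ (↭.map⁺ (λ γ → CNF (¬ γ)) Γ↭Γ′) (↭.map⁺ CNF Δ↭Δ′)

  EqnCong : List Poly → Eqn → Eqn → Set
  EqnCong G e e′ = diff e ∼[ G ] diff e′

  ClauseCong : List Poly → Clause → Clause → Set
  ClauseCong G c c′ =
    Pointwise (EqnCong G) (negs c) (negs c′) × Pointwise (EqnCong G) (poss c) (poss c′)

  ClauseCong-refl : ∀ {G c} → ClauseCong G c c
  ClauseCong-refl = Pointwise.refl ∼-refl , Pointwise.refl ∼-refl

  ClauseCong-∪ᶜ : ∀ {G c c′ d d′} → ClauseCong G c c′ → ClauseCong G d d′ →
                  ClauseCong G (c ∪ᶜ d) (c′ ∪ᶜ d′)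
  ClauseCong-∪ᶜ (n , p) (n′ , p′) = Pointwise.++⁺ n n′ , Pointwise.++⁺ p p′

  Pointwise-⊗ : ∀ {R : Clause → Clause → Set} →
                (∀ {c c′ d d′} → R c c′ → R d d′ → R (c ∪ᶜ d) (c′ ∪ᶜ d′)) →
                ∀ {A A′ B B′} → Pointwise R A A′ → Pointwise R B B′ →
                Pointwise R (A ⊗ B) (A′ ⊗ B′)
  Pointwise-⊗ ∪-pres []       B≈B′ = []
  Pointwise-⊗ ∪-pres (r ∷ rs) B≈B′ =
    Pointwise.++⁺ (Pointwise.map⁺ _ _ (Pointwise.map (∪-pres r) B≈B′)) (Pointwise-⊗ ∪-pres rs B≈B′)

  -- The negative literals of c′ lie in the ideal generated by those of c,
  -- so c′ has the smaller ideal.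
  IClause-resp-ClauseCong : ∀ {c c′} → ClauseCong (map diff (negs c)) c c′ →
                            IClause c′ → IClause c
  IClause-resp-ClauseCong {c} {c′} (n , p) =
    lift-resp InIdeal-resp-∼ (Pointwise.symmetric ∼-sym p) ∘ Any.map (InIdeal-mono negs′⊆)
    where
    negs′⊆ : All (InIdeal (map diff (negs c))) (map diff (negs c′))
    negs′⊆ = All.map⁺ (Pointwise.All-resp-Pointwise InIdeal-resp-∼ n
                         (All.map⁻ (All.tabulate gen)))

  module _ {a b G} {s t : GTm a b} (s∼t : ⟦ s ⟧ ∼[ G ] ⟦ t ⟧) where

    ⟦substTm⟧-cong : ∀ {u v} (w : Tm (Var1 a b) u v) → ⟦ substTm w s ⟧ ∼[ G ] ⟦ substTm w t ⟧
    ⟦substTm⟧-cong (var x)  = s∼t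
    ⟦substTm⟧-cong 𝟘        = ∼-refl
    ⟦substTm⟧-cong (con c)  = ∼-refl
    ⟦substTm⟧-cong (neg w)  = ∼-neg (⟦substTm⟧-cong w)
    ⟦substTm⟧-cong (w ⊕ w′) = ∼-+ (⟦substTm⟧-cong w) (⟦substTm⟧-cong w′)
    ⟦substTm⟧-cong (w ⊙ w′) = ∼-* (⟦substTm⟧-cong w) (⟦substTm⟧-cong w′)

    substEqn-cong : ∀ {u v} (p q : Tm (Var1 a b) u v) →
                    EqnCong G (u , v , substTm p s , substTm q s) (u , v , substTm p t , substTm q t)
    substEqn-cong p q = ∼-+ (⟦substTm⟧-cong p) (∼-neg (⟦substTm⟧-cong q))

    cnf⁺-subst-cong : ∀ φ → Pointwise (ClauseCong G) (cnf⁺ (φ [x↦ s ])) (cnf⁺ (φ [x↦ t ]))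
    cnf⁻-subst-cong : ∀ φ → Pointwise (ClauseCong G) (cnf⁻ (φ [x↦ s ])) (cnf⁻ (φ [x↦ t ]))
    cnf⁺-subst-cong (p ≈ q) = ([] , substEqn-cong p q ∷ []) ∷ []
    cnf⁺-subst-cong (¬ φ)   = cnf⁻-subst-cong φ
    cnf⁺-subst-cong (φ ∧ ψ) = Pointwise.++⁺ (cnf⁺-subst-cong φ) (cnf⁺-subst-cong ψ)
    cnf⁺-subst-cong (φ ∨ ψ) = Pointwise-⊗ ClauseCong-∪ᶜ (cnf⁺-subst-cong φ) (cnf⁺-subst-cong ψ)
    cnf⁺-subst-cong (φ ⇒ ψ) = Pointwise-⊗ ClauseCong-∪ᶜ (cnf⁻-subst-cong φ) (cnf⁺-subst-cong ψ)
    cnf⁻-subst-cong (p ≈ q) = (substEqn-cong p q ∷ [] , []) ∷ []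
    cnf⁻-subst-cong (¬ φ)   = cnf⁺-subst-cong φ
    cnf⁻-subst-cong (φ ∧ ψ) = Pointwise-⊗ ClauseCong-∪ᶜ (cnf⁻-subst-cong φ) (cnf⁻-subst-cong ψ)
    cnf⁻-subst-cong (φ ∨ ψ) = Pointwise.++⁺ (cnf⁻-subst-cong φ) (cnf⁻-subst-cong ψ)
    cnf⁻-subst-cong (φ ⇒ ψ) = Pointwise.++⁺ (cnf⁺-subst-cong φ) (cnf⁻-subst-cong ψ)

  IDisj-subst : ∀ {A A′ e L} →
                (∀ {G} → InIdeal G (diff e) → Pointwise (ClauseCong G) A A′) →
                IDisj (A′ ∷ (clause (e ∷ []) [] ∷ []) ∷ L) →
                IDisj (A ∷ (clause (e ∷ []) [] ∷ []) ∷ L)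
  IDisj-subst {e = e} A≈A′ valid (_∷_ {c = c} c∈ (_∷_ {d = r} (here refl) sel))
    with Pointwise-∈ˡ (A≈A′ (gen (∈-map⁺ diff (∈-++⁺ʳ (negs c) {e ∷ negs r} (here refl))))) c∈
  ... | c′ , c′∈ , c≈c′ =
    IClause-resp-ClauseCong (ClauseCong-∪ᶜ c≈c′ ClauseCong-refl) (valid (c′∈ ∷ here refl ∷ sel))

  IDisj-ax : ∀ {u v} (s t : GTm u v) L → IDisj (cnf⁻ (s ≈ t) ∷ cnf⁺ (s ≈ t) ∷ L)
  IDisj-ax s t L (here refl ∷ here refl ∷ _) = here (gen (here refl))

  IDisj-ref : ∀ {u v} (t : GTm u v) L → IDisj (cnf⁺ (t ≈ t) ∷ L)
  IDisj-ref t L (here refl ∷ _) = here ∼-refl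

  Axiom-sound : ∀ {S} → Axiom S → ISeq S
  Axiom-sound (ax {Γ} {Δ} s t) =
    IDisj⇒ISeq ((s ≈ t) ∷ Γ) ((s ≈ t) ∷ Δ)
      (IDisj-resp-↭ (prep _ (↭-sym (cnfs-succ-↭ Γ Δ (s ≈ t)))) (IDisj-ax s t (cnfs Γ Δ)))
  Axiom-sound (ref {Γ} {Δ} t) = IDisj⇒ISeq-succ Γ Δ (t ≈ t) (IDisj-ref t (cnfs Γ Δ))

  Rule₁-sound : ∀ {P S} → Rule₁ P S → ISeq P → ISeq S
  Rule₁-sound (weakL {Γ} {Δ} φ) =
    IDisj⇒ISeq (φ ∷ Γ) Δ ∘ IDisj-weaken ∘ ISeq⇒IDisj Γ Δ
  Rule₁-sound (weakR {Γ} {Δ} φ) =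
    IDisj⇒ISeq-succ Γ Δ φ ∘ IDisj-weaken ∘ ISeq⇒IDisj Γ Δ
  Rule₁-sound (contrL {Γ} {Δ} φ) =
    IDisj⇒ISeq (φ ∷ Γ) Δ ∘ IDisj-contract ∘ ISeq⇒IDisj (φ ∷ φ ∷ Γ) Δ
  Rule₁-sound (contrR {Γ} {Δ} φ) =
    IDisj⇒ISeq-succ Γ Δ φ ∘ IDisj-contract ∘
    IDisj-resp-↭ (prep _ (cnfs-succ-↭ Γ Δ φ)) ∘ ISeq⇒IDisj-succ Γ (φ ∷ Δ) φ
  Rule₁-sound (¬L {Γ} {Δ} φ) =
    IDisj⇒ISeq ((¬ φ) ∷ Γ) Δ ∘ ISeq⇒IDisj-succ Γ Δ φ
  Rule₁-sound (¬R {Γ} {Δ} φ) =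
    IDisj⇒ISeq-succ Γ Δ (¬ φ) ∘ ISeq⇒IDisj (φ ∷ Γ) Δ
  Rule₁-sound (∨R {Γ} {Δ} φ ψ) =
    IDisj⇒ISeq-succ Γ Δ (φ ∨ ψ) ∘ IDisj-⊗ ∘
    IDisj-resp-↭ (prep _ (cnfs-succ-↭ Γ Δ ψ)) ∘ ISeq⇒IDisj-succ Γ (ψ ∷ Δ) φ
  Rule₁-sound (∧L {Γ} {Δ} φ ψ) =
    IDisj⇒ISeq ((φ ∧ ψ) ∷ Γ) Δ ∘ IDisj-⊗ ∘ ISeq⇒IDisj (φ ∷ ψ ∷ Γ) Δ
  Rule₁-sound (⇒R {Γ} {Δ} φ ψ) =
    IDisj⇒ISeq-succ Γ Δ (φ ⇒ ψ) ∘ IDisj-⊗ ∘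
    IDisj-resp-↭ (prep _ (cnfs-succ-↭ Γ Δ ψ)) ∘ ISeq⇒IDisj (φ ∷ Γ) (ψ ∷ Δ)
  Rule₁-sound (sub {Γ} {Δ} φ s t) =
    IDisj⇒ISeq ((φ [x↦ s ]) ∷ (s ≈ t) ∷ Γ) Δ ∘ IDisj-subst (λ s∼t → cnf⁻-subst-cong s∼t φ) ∘
    ISeq⇒IDisj ((φ [x↦ t ]) ∷ (s ≈ t) ∷ Γ) Δ

  Rule₂-sound : ∀ {P Q S} → Rule₂ P Q S → ISeq P → ISeq Q → ISeq S
  Rule₂-sound (∨L {Γ} {Δ} φ ψ) h k =
    IDisj⇒ISeq ((φ ∨ ψ) ∷ Γ) Δ (IDisj-++ (ISeq⇒IDisj (φ ∷ Γ) Δ h) (ISeq⇒IDisj (ψ ∷ Γ) Δ k))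
  Rule₂-sound (∧R {Γ} {Δ} φ ψ) h k =
    IDisj⇒ISeq-succ Γ Δ (φ ∧ ψ) (IDisj-++ (ISeq⇒IDisj-succ Γ Δ φ h) (ISeq⇒IDisj-succ Γ Δ ψ k))
  Rule₂-sound (⇒L {Γ} {Δ} φ ψ) h k =
    IDisj⇒ISeq ((φ ⇒ ψ) ∷ Γ) Δ (IDisj-++ (ISeq⇒IDisj-succ Γ Δ φ h) (ISeq⇒IDisj (ψ ∷ Γ) Δ k))

lemma3p12 : (O : Set) (C : O → O → Set) → let open Sig O C in
    (∀ S → Axiomᵐ S → ISeq S) ×
    (∀ P S → Rule₁ᵐ P S → ISeq P → ISeq S) ×
    (∀ P Q S → Rule₂ᵐ P Q S → ISeq P → ISeq Q → ISeq S)
lemma3p12 O C =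
    (λ { S (S₀ , a , S≋) → ISeq-resp-≋ (≋-sym S≋) (Axiom-sound a) })
  , (λ { P S (P₀ , S₀ , r , P≋ , S≋) h →
         ISeq-resp-≋ (≋-sym S≋) (Rule₁-sound r (ISeq-resp-≋ P≋ h)) })
  , (λ { P Q S (P₀ , Q₀ , S₀ , r , P≋ , Q≋ , S≋) h k →
         ISeq-resp-≋ (≋-sym S≋) (Rule₂-sound r (ISeq-resp-≋ P≋ h) (ISeq-resp-≋ Q≋ k)) })
  where open Soundness O C
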